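{- Let $n\geq 1$ be an integer and let $k=p2^{q}$, where $p$ is an odd positive integer and $q$ is a positive integer. Let $G$ be a complete balanced $k$-partite graph with $n$ vertices in each part. Then $W(G)\geq (2k-p-q)n-1$.
   Context: All graphs are finite, undirected, without loops or multiple edges. A complete $k$-partite graph is a graph whose vertex set is partitioned into $k$ independent sets $V_1,\ldots,V_k$ such that every vertex of $V_i$ is adjacent to every vertex of $V_j$ for all $i\neq j$; it is balanced if $|V_1|=\cdots=|V_k|$. An edge-coloring of a graph $G$ with colors $1,\ldots,t$ is an interval $t$-coloring if every color $1,\ldots,t$ is used on at least one edge, and for each vertex the colors of the edges incident to it are pairwise distinct and form a set of consecutive integers. $G$ is interval colorable if it has an interval $t$-coloring for some positive integer $t$; for an interval colorable $G$, $W(G)$ denotes the greatest $t$ such that $G$ has an interval $t$-coloring. -}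

module Defs where

open import Data.Nat using (ℕ; zero; suc; _+_; _*_; _∸_; _^_; _≤_; _<_)
open import Data.Nat.Properties using ()
open import Data.Fin using (Fin)
open import Data.Product using (Σ; ∃; _×_; _,_)
open import Relation.Binary.PropositionalEquality using (_≡_; _≢_)
open import Relation.Nullary using (¬_)
open import Level using (0ℓ)

record Graph : Set₁ where
  field
    N      : ℕ
    Adj    : Fin N → Fin N → Set
    sym    : ∀ {u v} → Adj u v → Adj v u
    irrefl : ∀ {v} → ¬ Adj v v
open Graph public

record EdgeColoring (G : Graph) : Set where
  field
    col     : ∀ (u v : Fin (N G)) → Adj G u v → ℕ
    col-sym : ∀ u v (e : Adj G u v) → col u v e ≡ col v u (sym G e)
open EdgeColoring public

record IsIntervalColoring (G : Graph) (t : ℕ) (c : EdgeColoring G) : Set where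
  field
    range    : ∀ u v (e : Adj G u v) → 1 ≤ col c u v e × col c u v e ≤ t
    surj     : ∀ i → 1 ≤ i → i ≤ t →
               Σ (Fin (N G)) λ u → Σ (Fin (N G)) λ v → Σ (Adj G u v) λ e → col c u v e ≡ i
    proper   : ∀ v u w (e : Adj G v u) (f : Adj G v w) → u ≢ w → col c v u e ≢ col c v w f
    interval : ∀ v u (e : Adj G v u) →
               Σ ℕ λ lo → Σ ℕ λ hi →
                 (∀ w (f : Adj G v w) → lo ≤ col c v w f × col c v w f ≤ hi) ×
                 (∀ i → lo ≤ i → i ≤ hi →
                    Σ (Fin (N G)) λ w → Σ (Adj G v w) λ f → col c v w f ≡ i)

HasIntervalColoring : Graph → ℕ → Set
HasIntervalColoring G t = Σ (EdgeColoring G) (IsIntervalColoring G t)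

-- For an interval colorable G, W(G) ≥ m  iff  G has an interval t-coloring for some t ≥ m.
W≥ : Graph → ℕ → Set
W≥ G m = Σ ℕ λ t → m ≤ t × HasIntervalColoring G t

open import Data.Fin using (toℕ)
open import Data.Nat.DivMod using (_/_)

partOf : (k n : ℕ) → Fin (k * n) → ℕ
partOf k zero x = 0
partOf k (suc n) x = toℕ x / suc n

K-balanced : (k n : ℕ) → Graph
K-balanced k n = record
  { N = k * n
  ; Adj = λ u v → partOf k n u ≢ partOf k n v
  ; sym = λ ne eq → ne (Relation.Binary.PropositionalEquality.sym eq)
  ; irrefl = λ ne → ne Relation.Binary.PropositionalEquality.refl
  }

module Submission where

-- The central notion is a *complete interval colouring* of the complete
-- graph on a finite type V with spread d and span t: the colours are
-- 0, …, t − 1, the colours at each vertex u form exactly the d consecutive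
-- values low u, …, low u + d − 1, every colour below t occurs, and some
-- vertex reaches the top colour t − 1.  The file develops, in order:
--   * relabelling such colourings along bijections of the vertex set;
--   * doubling: from K_m with spread d and span t to K_{2m} with spread
--     2d + 1 and span t + 2d + 1 (two copies of the old colouring, shifted
--     apart, joined by a shifted "closed star");
--   * the base: K_{2p} has such a colouring with spread 2p − 1 and span 3p − 2;
--   * blow-up: replacing every vertex of K_k by n independent vertices turns
--     a colouring of span t into an interval (nt + n − 1)-colouring of the
--     complete balanced k-partite graph with parts of size n;
--   * the tower: doubling the base q − 1 times gives K_{p·2^q} with span t
--     satisfying 2k = t + 1 + p + q, so nt + n − 1 = (2k − p − q)·n − 1,
--     which is the theorem.

open import Defs
open import Data.Nat using (ℕ; _*_; _∸_; _^_; _≤_; _%_)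
open import Relation.Binary.PropositionalEquality using (_≡_)

open import Data.Nat
open import Data.Nat.Properties
open import Data.Nat.DivMod
open import Data.Nat.Tactic.RingSolver using (solve-∀)
import Data.Fin as Fin
open Fin using (Fin; toℕ; fromℕ<; fromℕ; combine; remQuot; splitAt; join)
open import Data.Fin.Properties as FinP
  using (toℕ-injective; toℕ<n; toℕ-fromℕ<; toℕ-fromℕ; remQuot-combine; combine-remQuot;
         toℕ-combine; splitAt-join; join-splitAt)
open import Data.Product using (Σ; _×_; _,_; proj₁; proj₂)
open import Data.Sum using (_⊎_; inj₁; inj₂)
open import Data.Sum.Properties using (inj₁-injective; inj₂-injective; ≡-dec)
open import Data.Empty using (⊥-elim)
open import Function using (_∘_)
open import Relation.Nullary using (yes; no)
open import Relation.Binary.Definitions using (DecidableEquality; tri<; tri≈; tri>)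
open import Relation.Binary.PropositionalEquality
  using (_≢_; refl; trans; cong; cong₂; subst; subst₂; module ≡-Reasoning)
  renaming (sym to ≡-sym)

∸-<-shift : ∀ {a b s} → s ≤ a → a < b + s → a ∸ s < b
∸-<-shift {a} {b} {s} s≤a a<b+s =
  +-cancelʳ-< s (a ∸ s) b (subst (_< b + s) (≡-sym (m∸n+n≡m s≤a)) a<b+s)

pred-above : ∀ {a y} → a < y → a ≤ pred y × pred y < y × suc (pred y) ≡ y
pred-above {y = suc y} (s≤s a≤y) = a≤y , ≤-refl , refl

-- Colours are 0-based here; the shift to the colours 1, …, t of the paper
-- happens only in the blow-up.  `nbr u x` is the neighbour of u joined to it
-- by the edge of colour x, so each vertex sees each colour of its star once.
record CompleteIntervalColouring (V : Set) (d t : ℕ) : Set where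
  field
    decEq      : DecidableEquality V
    colour     : V → V → ℕ
    colour-sym : ∀ u v → colour u v ≡ colour v u
    low        : V → ℕ
    low≤colour : ∀ u v → u ≢ v → low u ≤ colour u v
    colour<    : ∀ u v → u ≢ v → colour u v < low u + d
    nbr        : V → ℕ → V
    nbr-≢      : ∀ u x → low u ≤ x → x < low u + d → u ≢ nbr u x
    colour-nbr : ∀ u x → low u ≤ x → x < low u + d → colour u (nbr u x) ≡ x
    nbr-colour : ∀ u v → u ≢ v → nbr u (colour u v) ≡ v
    low-bound  : ∀ u → low u + d ≤ t
    covered    : ∀ x → x < t → Σ V λ u → low u ≤ x × x < low u + d
    top        : V
    top-low    : low top + d ≡ t

relabel : ∀ {V W : Set} {d t} → CompleteIntervalColouring V d t →
          (f : W → V) (g : V → W) → (∀ v → f (g v) ≡ v) → (∀ w → g (f w) ≡ w) →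
          CompleteIntervalColouring W d t
relabel {V} {W} {d} {t} C f g fg gf = record
  { decEq      = decEqW
  ; colour     = λ u v → colour (f u) (f v)
  ; colour-sym = λ u v → colour-sym (f u) (f v)
  ; low        = λ u → low (f u)
  ; low≤colour = λ u v u≢v → low≤colour (f u) (f v) (f-≢ u≢v)
  ; colour<    = λ u v u≢v → colour< (f u) (f v) (f-≢ u≢v)
  ; nbr        = λ u x → g (nbr (f u) x)
  ; nbr-≢      = λ u x lo hi u≡ → nbr-≢ (f u) x lo hi (trans (cong f u≡) (fg _))
  ; colour-nbr = λ u x lo hi → trans (cong (colour (f u)) (fg _)) (colour-nbr (f u) x lo hi)
  ; nbr-colour = λ u v u≢v → trans (cong g (nbr-colour (f u) (f v) (f-≢ u≢v))) (gf v)
  ; low-bound  = λ u → low-bound (f u)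
  ; covered    = coveredW
  ; top        = g top
  ; top-low    = trans (cong (λ z → low z + d) (fg top)) top-low
  }
  where
    open CompleteIntervalColouring C
    f-injective : ∀ {u v} → f u ≡ f v → u ≡ v
    f-injective {u} {v} e = trans (≡-sym (gf u)) (trans (cong g e) (gf v))
    f-≢ : ∀ {u v} → u ≢ v → f u ≢ f v
    f-≢ u≢v = u≢v ∘ f-injective
    decEqW : DecidableEquality W
    decEqW u v with decEq (f u) (f v)
    ... | yes e = yes (f-injective e)
    ... | no ne = no (ne ∘ cong f)
    coveredW : ∀ x → x < t → Σ W λ u → low (f u) ≤ x × x < low (f u) + d
    coveredW x x<t with covered x x<t
    ... | u , lo , hi = g u , subst (λ z → low z ≤ x) (≡-sym (fg u)) lo
                             , subst (λ z → x < low z + d) (≡-sym (fg u)) hi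

onFin : ∀ {m d t} → CompleteIntervalColouring (Fin m ⊎ Fin m) d t →
        CompleteIntervalColouring (Fin (m + m)) d t
onFin {m} C = relabel C (splitAt m) (join m m) (splitAt-join m m) (join-splitAt m m)

module Doubling {V : Set} {d t : ℕ} (C : CompleteIntervalColouring V d t) where
  open CompleteIntervalColouring C

  -- The closed star of u: u itself gets colour low u, every other vertex v
  -- gets colour u v + 1.  It is a bijection from V onto [low u, low u + d];
  -- its shift by d colours the edges between the two copies of V.
  closed : V → V → ℕ
  closed u v with decEq u v
  ... | yes _ = low u
  ... | no _  = suc (colour u v)

  closed-self : ∀ u → closed u u ≡ low u
  closed-self u with decEq u u
  ... | yes _   = refl
  ... | no u≢u = ⊥-elim (u≢u refl)

  closed-≢ : ∀ {u v} → u ≢ v → closed u v ≡ suc (colour u v)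
  closed-≢ {u} {v} u≢v with decEq u v
  ... | yes u≡v = ⊥-elim (u≢v u≡v)
  ... | no _    = refl

  closed-sym : ∀ u v → closed u v ≡ closed v u
  closed-sym u v with decEq u v
  ... | yes refl = ≡-sym (closed-self u)
  ... | no u≢v  = trans (cong suc (colour-sym u v)) (≡-sym (closed-≢ (u≢v ∘ ≡-sym)))

  closed-range : ∀ u v → low u ≤ closed u v × closed u v ≤ low u + d
  closed-range u v with decEq u v
  ... | yes _   = ≤-refl , m≤m+n (low u) d
  ... | no u≢v = ≤-trans (low≤colour u v u≢v) (n≤1+n _) , colour< u v u≢v

  closedNbr : V → ℕ → V
  closedNbr u y with y ≟ low u
  ... | yes _ = u
  ... | no _  = nbr u (pred y)

  closedNbr-low : ∀ u → closedNbr u (low u) ≡ u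
  closedNbr-low u with low u ≟ low u
  ... | yes _ = refl
  ... | no ne = ⊥-elim (ne refl)

  closedNbr-above : ∀ u y → low u < y → closedNbr u y ≡ nbr u (pred y)
  closedNbr-above u y lo<y with y ≟ low u
  ... | yes refl = ⊥-elim (<-irrefl refl lo<y)
  ... | no _     = refl

  closed-closedNbr : ∀ u y → low u ≤ y → y ≤ low u + d → closed u (closedNbr u y) ≡ y
  closed-closedNbr u y lo≤y y≤hi with m≤n⇒m<n∨m≡n lo≤y
  ... | inj₂ refl = trans (cong (closed u) (closedNbr-low u)) (closed-self u)
  ... | inj₁ lo<y with pred-above lo<y
  ...   | lo≤y′ , y′<y , suc-y′ = begin
      closed u (closedNbr u y)        ≡⟨ cong (closed u) (closedNbr-above u y lo<y) ⟩
      closed u (nbr u (pred y))       ≡⟨ closed-≢ (nbr-≢ u (pred y) lo≤y′ y′<hi) ⟩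
      suc (colour u (nbr u (pred y))) ≡⟨ cong suc (colour-nbr u (pred y) lo≤y′ y′<hi) ⟩
      suc (pred y)                    ≡⟨ suc-y′ ⟩
      y                               ∎
    where
      open ≡-Reasoning
      y′<hi : pred y < low u + d
      y′<hi = <-≤-trans y′<y y≤hi

  closedNbr-closed : ∀ u v → closedNbr u (closed u v) ≡ v
  closedNbr-closed u v with decEq u v
  ... | yes refl = closedNbr-low u
  ... | no u≢v  = trans (closedNbr-above u _ (s≤s (low≤colour u v u≢v))) (nbr-colour u v u≢v)

  d₂ : ℕ
  d₂ = suc (d + d)

  colour₂ : V ⊎ V → V ⊎ V → ℕ
  colour₂ (inj₁ u) (inj₁ v) = colour u v
  colour₂ (inj₁ u) (inj₂ v) = closed u v + d
  colour₂ (inj₂ u) (inj₁ v) = closed u v + d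
  colour₂ (inj₂ u) (inj₂ v) = colour u v + d₂

  colour₂-sym : ∀ u v → colour₂ u v ≡ colour₂ v u
  colour₂-sym (inj₁ u) (inj₁ v) = colour-sym u v
  colour₂-sym (inj₁ u) (inj₂ v) = cong (_+ d) (closed-sym u v)
  colour₂-sym (inj₂ u) (inj₁ v) = cong (_+ d) (closed-sym u v)
  colour₂-sym (inj₂ u) (inj₂ v) = cong (_+ d₂) (colour-sym u v)

  -- A vertex of the first copy sees [low, low + d) and then the cross
  -- edges; one of the second copy sees the cross edges and then the
  -- raised old colours.
  low₂ : V ⊎ V → ℕ
  low₂ (inj₁ u) = low u
  low₂ (inj₂ u) = low u + d

  d≤d₂ : d ≤ d₂
  d≤d₂ = ≤-trans (m≤m+n d d) (n≤1+n _)

  cross<hi : ∀ u v → closed u v + d < low u + d₂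
  cross<hi u v = ≤-<-trans (subst (closed u v + d ≤_) (+-assoc (low u) d d)
                                  (+-monoˡ-≤ d (proj₂ (closed-range u v))))
                           (+-monoʳ-< (low u) (n<1+n (d + d)))

  low₂≤colour₂ : ∀ u v → u ≢ v → low₂ u ≤ colour₂ u v
  low₂≤colour₂ (inj₁ u) (inj₁ v) ne = low≤colour u v (ne ∘ cong inj₁)
  low₂≤colour₂ (inj₁ u) (inj₂ v) _  = ≤-trans (proj₁ (closed-range u v)) (m≤m+n _ d)
  low₂≤colour₂ (inj₂ u) (inj₁ v) _  = +-monoˡ-≤ d (proj₁ (closed-range u v))
  low₂≤colour₂ (inj₂ u) (inj₂ v) ne = +-mono-≤ (low≤colour u v (ne ∘ cong inj₂)) d≤d₂

  colour₂< : ∀ u v → u ≢ v → colour₂ u v < low₂ u + d₂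
  colour₂< (inj₁ u) (inj₁ v) ne = <-≤-trans (colour< u v (ne ∘ cong inj₁)) (+-monoʳ-≤ (low u) d≤d₂)
  colour₂< (inj₁ u) (inj₂ v) _  = cross<hi u v
  colour₂< (inj₂ u) (inj₁ v) _  = <-≤-trans (cross<hi u v) (+-monoˡ-≤ d₂ (m≤m+n (low u) d))
  colour₂< (inj₂ u) (inj₂ v) ne = +-monoˡ-< d₂ (colour< u v (ne ∘ cong inj₂))

  nbr₂ : V ⊎ V → ℕ → V ⊎ V
  nbr₂ (inj₁ u) x with x <? low u + d
  ... | yes _ = inj₁ (nbr u x)
  ... | no _  = inj₂ (closedNbr u (x ∸ d))
  nbr₂ (inj₂ u) x with x <? low u + d₂
  ... | yes _ = inj₁ (closedNbr u (x ∸ d))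
  ... | no _  = inj₂ (nbr u (x ∸ d₂))

  cross-colour : ∀ u x → low u + d ≤ x → x < low u + d₂ → closed u (closedNbr u (x ∸ d)) + d ≡ x
  cross-colour u x lo≤x x<hi = trans (cong (_+ d) (closed-closedNbr u (x ∸ d) lo≤y y≤hi))
                                     (m∸n+n≡m (≤-trans (m≤n+m d (low u)) lo≤x))
    where
      lo≤y : low u ≤ x ∸ d
      lo≤y = m+n≤o⇒m≤o∸n (low u) lo≤x
      y≤hi : x ∸ d ≤ low u + d
      y≤hi = m≤n+o⇒m∸n≤o x d (subst (x ≤_) (rearrange (low u) d) (≤-pred (subst (x <_) (+-suc (low u) (d + d)) x<hi)))
        where rearrange : ∀ a d → a + (d + d) ≡ d + (a + d)
              rearrange = solve-∀

  nbr₂-ok : ∀ u x → low₂ u ≤ x → x < low₂ u + d₂ → u ≢ nbr₂ u x × colour₂ u (nbr₂ u x) ≡ x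
  nbr₂-ok (inj₁ u) x lo≤x x<hi with x <? low u + d
  ... | yes x<m = (λ e → nbr-≢ u x lo≤x x<m (inj₁-injective e)) , colour-nbr u x lo≤x x<m
  ... | no x≮m  = (λ ()) , cross-colour u x (≮⇒≥ x≮m) x<hi
  nbr₂-ok (inj₂ u) x lo≤x x<hi with x <? low u + d₂
  ... | yes x<m = (λ ()) , cross-colour u x lo≤x x<m
  ... | no x≮m  = (λ e → nbr-≢ u y lo≤y y<hi (inj₂-injective e))
                , trans (cong (_+ d₂) (colour-nbr u y lo≤y y<hi)) (m∸n+n≡m d₂≤x)
    where
      y = x ∸ d₂
      d₂≤x : d₂ ≤ x
      d₂≤x = ≤-trans (m≤n+m d₂ (low u)) (≮⇒≥ x≮m)
      lo≤y : low u ≤ y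
      lo≤y = m+n≤o⇒m≤o∸n (low u) (≮⇒≥ x≮m)
      y<hi : y < low u + d
      y<hi = ∸-<-shift d₂≤x x<hi

  nbr₂-colour₂ : ∀ u v → u ≢ v → nbr₂ u (colour₂ u v) ≡ v
  nbr₂-colour₂ (inj₁ u) (inj₁ v) ne with colour u v <? low u + d
  ... | yes _ = cong inj₁ (nbr-colour u v (ne ∘ cong inj₁))
  ... | no not-below = ⊥-elim (not-below (colour< u v (ne ∘ cong inj₁)))
  nbr₂-colour₂ (inj₁ u) (inj₂ v) _ with closed u v + d <? low u + d
  ... | yes below = ⊥-elim (<⇒≱ below (+-monoˡ-≤ d (proj₁ (closed-range u v))))
  ... | no _  = cong inj₂ (trans (cong (closedNbr u) (m+n∸n≡m _ d)) (closedNbr-closed u v))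
  nbr₂-colour₂ (inj₂ u) (inj₁ v) _ with closed u v + d <? low u + d₂
  ... | yes _ = cong inj₁ (trans (cong (closedNbr u) (m+n∸n≡m _ d)) (closedNbr-closed u v))
  ... | no not-below = ⊥-elim (not-below (cross<hi u v))
  nbr₂-colour₂ (inj₂ u) (inj₂ v) ne with colour u v + d₂ <? low u + d₂
  ... | yes below = ⊥-elim (<⇒≱ below (+-monoˡ-≤ d₂ (low≤colour u v (ne ∘ cong inj₂))))
  ... | no _  = cong inj₂ (trans (cong (nbr u) (m+n∸n≡m _ d₂)) (nbr-colour u v (ne ∘ cong inj₂)))

  low₂-bound : ∀ u → low₂ u + d₂ ≤ t + d₂
  low₂-bound (inj₁ u) = +-monoˡ-≤ d₂ (≤-trans (m≤m+n (low u) d) (low-bound u))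
  low₂-bound (inj₂ u) = +-monoˡ-≤ d₂ (low-bound u)

  covered₂ : ∀ x → x < t + d₂ → Σ (V ⊎ V) λ u → low₂ u ≤ x × x < low₂ u + d₂
  covered₂ x x<hi with x <? t
  ... | yes x<t with covered x x<t
  ...   | u , lo≤x , x<u = inj₁ u , lo≤x , <-≤-trans x<u (+-monoʳ-≤ (low u) d≤d₂)
  covered₂ x x<hi | no x≮t =
    inj₂ top , subst (_≤ x) (≡-sym top-low) (≮⇒≥ x≮t) , subst (λ z → x < z + d₂) (≡-sym top-low) x<hi

  double : CompleteIntervalColouring (V ⊎ V) d₂ (t + d₂)
  double = record
    { decEq      = ≡-dec decEq decEq
    ; colour     = colour₂
    ; colour-sym = colour₂-sym
    ; low        = low₂
    ; low≤colour = low₂≤colour₂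
    ; colour<    = colour₂<
    ; nbr        = nbr₂
    ; nbr-≢      = λ u x lo hi → proj₁ (nbr₂-ok u x lo hi)
    ; colour-nbr = λ u x lo hi → proj₂ (nbr₂-ok u x lo hi)
    ; nbr-colour = nbr₂-colour₂
    ; low-bound  = low₂-bound
    ; covered    = covered₂
    ; top        = inj₂ top
    ; top-low    = cong (_+ d₂) top-low
    }

open Doubling using (double)

-- The base: a complete interval colouring of K_{2p} with spread 2p − 1 and
-- span 3p − 2.  The vertices are two copies, left i and right i, of
-- {0, …, p − 1}, with p = r + 1.  Edges inside a copy get the "middle"
-- colours r + (i + j mod p);
-- the edge left i — right j gets a colour below r when j < i, the middle
-- colour r + (2i mod p) when j = i (the middle colour missing at both ends),
-- and a colour above 2r when j > i.  Left i sees [r − i, 3r − i], right j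
-- sees [j, j + 2r].
module Base (r : ℕ) where
  p : ℕ
  p = suc r

  spread span : ℕ
  spread = suc (r + r)
  span   = r + spread

  r≤spread : r ≤ spread
  r≤spread = ≤-trans (m≤m+n r r) (n≤1+n _)

  _⊕_ : ℕ → ℕ → ℕ
  a ⊕ b = (a + b) % p

  _⊖_ : ℕ → ℕ → ℕ
  a ⊖ y = (y + (p ∸ a)) % p

  %-absorbˡ : ∀ a b → (a % p + b) % p ≡ (a + b) % p
  %-absorbˡ a b = begin
      (a % p + b) % p         ≡⟨ %-distribˡ-+ (a % p) b p ⟩
      (a % p % p + b % p) % p ≡⟨ cong (λ z → (z + b % p) % p) (m%n%n≡m%n a p) ⟩
      (a % p + b % p) % p     ≡⟨ %-distribˡ-+ a b p ⟨
      (a + b) % p             ∎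
    where open ≡-Reasoning

  ⊖-⊕ : ∀ a b → a < p → b < p → a ⊖ (a ⊕ b) ≡ b
  ⊖-⊕ a b a<p b<p = begin
      ((a + b) % p + (p ∸ a)) % p ≡⟨ %-absorbˡ (a + b) (p ∸ a) ⟩
      (a + b + (p ∸ a)) % p       ≡⟨ cong (_% p) (rearrange a b (p ∸ a)) ⟩
      (b + (a + (p ∸ a))) % p     ≡⟨ cong (λ z → (b + z) % p) (m+[n∸m]≡n (<⇒≤ a<p)) ⟩
      (b + p) % p                 ≡⟨ [m+n]%n≡m%n b p ⟩
      b % p                       ≡⟨ m<n⇒m%n≡m b<p ⟩
      b                           ∎
    where
      open ≡-Reasoning
      rearrange : ∀ a b c → a + b + c ≡ b + (a + c)
      rearrange = solve-∀

  ⊕-⊖ : ∀ a y → a < p → y < p → a ⊕ (a ⊖ y) ≡ y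
  ⊕-⊖ a y a<p y<p = begin
      (a + (y + (p ∸ a)) % p) % p ≡⟨ cong (_% p) (+-comm a _) ⟩
      ((y + (p ∸ a)) % p + a) % p ≡⟨ %-absorbˡ (y + (p ∸ a)) a ⟩
      (y + (p ∸ a) + a) % p       ≡⟨ cong (_% p) (+-assoc y (p ∸ a) a) ⟩
      (y + ((p ∸ a) + a)) % p     ≡⟨ cong (λ z → (y + z) % p) (m∸n+n≡m (<⇒≤ a<p)) ⟩
      (y + p) % p                 ≡⟨ [m+n]%n≡m%n y p ⟩
      y % p                       ≡⟨ m<n⇒m%n≡m y<p ⟩
      y                           ∎
    where open ≡-Reasoning

  fin : ℕ → Fin p
  fin a = fromℕ< (m%n<n a p)

  toℕ-fin : ∀ {a} → a < p → toℕ (fin a) ≡ a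
  toℕ-fin a<p = trans (toℕ-fromℕ< _) (m<n⇒m%n≡m a<p)

  fin-toℕ : ∀ i → fin (toℕ i) ≡ i
  fin-toℕ i = toℕ-injective (toℕ-fin (toℕ<n i))

  ≤r : ∀ (i : Fin p) → toℕ i ≤ r
  ≤r i = ≤-pred (toℕ<n i)

  mid : Fin p → Fin p → ℕ
  mid i j = toℕ i ⊕ toℕ j

  mid<p : ∀ i j → mid i j < p
  mid<p i j = m%n<n (toℕ i + toℕ j) p

  mid-sym : ∀ i j → mid i j ≡ mid j i
  mid-sym i j = cong (_% p) (+-comm (toℕ i) (toℕ j))

  partner : Fin p → ℕ → Fin p
  partner i y = fin (toℕ i ⊖ y)

  mid-partner : ∀ i y → y < p → mid i (partner i y) ≡ y
  mid-partner i y y<p = trans (cong (toℕ i ⊕_) (toℕ-fin (m%n<n (y + (p ∸ toℕ i)) p))) (⊕-⊖ (toℕ i) y (toℕ<n i) y<p)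

  partner-mid : ∀ i j → partner i (mid i j) ≡ j
  partner-mid i j = trans (cong fin (⊖-⊕ (toℕ i) (toℕ j) (toℕ<n i) (toℕ<n j))) (fin-toℕ j)

  middle-range : ∀ a i j → a ≤ r → a ≤ mid i j + r × mid i j + r < a + spread
  middle-range a i j a≤r = ≤-trans a≤r (m≤n+m r _)
                         , ≤-trans (s≤s (+-monoˡ-≤ r (≤-pred (mid<p i j)))) (m≤n+m spread a)

  cross : Fin p → Fin p → ℕ
  cross i j with <-cmp (toℕ j) (toℕ i)
  ... | tri< _ _ _ = toℕ j + (r ∸ toℕ i)
  ... | tri≈ _ _ _ = mid i i + r
  ... | tri> _ _ _ = r + r + (toℕ j ∸ toℕ i)

  cross-< : ∀ i j → toℕ j < toℕ i → cross i j ≡ toℕ j + (r ∸ toℕ i)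
  cross-< i j j<i with <-cmp (toℕ j) (toℕ i)
  ... | tri< _ _ _  = refl
  ... | tri≈ _ e _  = ⊥-elim (<⇒≢ j<i e)
  ... | tri> _ _ j>i = ⊥-elim (<⇒≯ j<i j>i)

  cross-≡ : ∀ i → cross i i ≡ mid i i + r
  cross-≡ i with <-cmp (toℕ i) (toℕ i)
  ... | tri< i<i _ _ = ⊥-elim (<-irrefl refl i<i)
  ... | tri≈ _ _ _   = refl
  ... | tri> _ _ i>i = ⊥-elim (<-irrefl refl i>i)

  cross-> : ∀ i j → toℕ i < toℕ j → cross i j ≡ r + r + (toℕ j ∸ toℕ i)
  cross-> i j i<j with <-cmp (toℕ j) (toℕ i)
  ... | tri< j<i _ _ = ⊥-elim (<⇒≯ j<i i<j)
  ... | tri≈ _ e _   = ⊥-elim (<⇒≢ i<j (≡-sym e))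
  ... | tri> _ _ _   = refl

  cross-range-left : ∀ i j → r ∸ toℕ i ≤ cross i j × cross i j < (r ∸ toℕ i) + spread
  cross-range-left i j with <-cmp (toℕ j) (toℕ i)
  ... | tri< _ _ _ = m≤n+m _ _ , subst (_< (r ∸ toℕ i) + spread) (+-comm (r ∸ toℕ i) (toℕ j))
                                       (+-monoʳ-< (r ∸ toℕ i) (s≤s (≤-trans (≤r j) (m≤m+n r r))))
  ... | tri≈ _ _ _ = middle-range _ i i (m∸n≤m r (toℕ i))
  ... | tri> _ _ _ = ≤-trans (m∸n≤m r (toℕ i)) (≤-trans (m≤m+n r r) (m≤m+n (r + r) _))
                   , subst (r + r + (toℕ j ∸ toℕ i) <_) (rearrange (r ∸ toℕ i) (r + r))
                           (s≤s (+-monoʳ-≤ (r + r) (∸-monoˡ-≤ (toℕ i) (≤r j))))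
    where rearrange : ∀ a b → suc (b + a) ≡ a + suc b
          rearrange = solve-∀

  cross-range-right : ∀ i j → toℕ j ≤ cross i j × cross i j < toℕ j + spread
  cross-range-right i j with <-cmp (toℕ j) (toℕ i)
  ... | tri< _ _ _ = m≤m+n _ _ , +-monoʳ-< (toℕ j) (s≤s (≤-trans (m∸n≤m r (toℕ i)) (m≤m+n r r)))
  ... | tri≈ _ _ _ = middle-range _ i i (≤r j)
  ... | tri> _ _ _ = ≤-trans (≤r j) (≤-trans (m≤m+n r r) (m≤m+n (r + r) _))
                   , subst (r + r + (toℕ j ∸ toℕ i) <_) (rearrange (toℕ j) (r + r))
                           (s≤s (+-monoʳ-≤ (r + r) (m∸n≤m (toℕ j) (toℕ i))))
    where rearrange : ∀ a b → suc (b + a) ≡ a + suc b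
          rearrange = solve-∀

  V : Set
  V = Fin p ⊎ Fin p

  colour : V → V → ℕ
  colour (inj₁ i) (inj₁ j) = mid i j + r
  colour (inj₂ i) (inj₂ j) = mid i j + r
  colour (inj₁ i) (inj₂ j) = cross i j
  colour (inj₂ j) (inj₁ i) = cross i j

  colour-sym : ∀ u v → colour u v ≡ colour v u
  colour-sym (inj₁ i) (inj₁ j) = cong (_+ r) (mid-sym i j)
  colour-sym (inj₂ i) (inj₂ j) = cong (_+ r) (mid-sym i j)
  colour-sym (inj₁ i) (inj₂ j) = refl
  colour-sym (inj₂ j) (inj₁ i) = refl

  low : V → ℕ
  low (inj₁ i) = r ∸ toℕ i
  low (inj₂ j) = toℕ j

  colour-range : ∀ u v → low u ≤ colour u v × colour u v < low u + spread
  colour-range (inj₁ i) (inj₁ j) = middle-range _ i j (m∸n≤m r (toℕ i))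
  colour-range (inj₂ i) (inj₂ j) = middle-range _ i j (≤r i)
  colour-range (inj₁ i) (inj₂ j) = cross-range-left i j
  colour-range (inj₂ j) (inj₁ i) = cross-range-right i j

  Carries : V → ℕ → V → Set
  Carries u x w = u ≢ w × colour u w ≡ x

  data Region (x : ℕ) : Set where
    below  : x < r → Region x
    middle : r ≤ x → x < spread → Region x
    above  : spread ≤ x → Region x

  region : ∀ x → Region x
  region x with x <? r
  ... | yes x<r = below x<r
  ... | no x≮r with x <? spread
  ...   | yes x<s = middle (≮⇒≥ x≮r) x<s
  ...   | no x≮s  = above (≮⇒≥ x≮s)

  byRegion : {A : Set} → ℕ → A → A → A → A
  byRegion x a b c with region x
  ... | below _    = a
  ... | middle _ _ = b
  ... | above _    = c

  byRegion-below : ∀ {A : Set} {x} {a b c : A} → x < r → byRegion x a b c ≡ a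
  byRegion-below {x = x} x<r with region x
  ... | below _       = refl
  ... | middle r≤x _  = ⊥-elim (<⇒≱ x<r r≤x)
  ... | above s≤x     = ⊥-elim (<⇒≱ x<r (≤-trans r≤spread s≤x))

  byRegion-middle : ∀ {A : Set} {x} {a b c : A} → r ≤ x → x < spread → byRegion x a b c ≡ b
  byRegion-middle {x = x} r≤x x<s with region x
  ... | below x<r    = ⊥-elim (<⇒≱ x<r r≤x)
  ... | middle _ _   = refl
  ... | above s≤x    = ⊥-elim (<⇒≱ x<s s≤x)

  byRegion-above : ∀ {A : Set} {x} {a b c : A} → spread ≤ x → byRegion x a b c ≡ c
  byRegion-above {x = x} s≤x with region x
  ... | below x<r    = ⊥-elim (<⇒≱ x<r (≤-trans r≤spread s≤x))
  ... | middle _ x<s = ⊥-elim (<⇒≱ x<s s≤x)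
  ... | above _      = refl

  -- The neighbour of i along middle colour r + y inside the copy `same`:
  -- same (partner i y), unless that is i itself, in which case y is the
  -- middle colour missing inside the copy and it is carried by other i.
  middleNbr : (Fin p → V) → (Fin p → V) → Fin p → ℕ → V
  middleNbr same other i y with partner i y FinP.≟ i
  ... | yes _ = other i
  ... | no _  = same (partner i y)

  module MiddleBlock (same other : Fin p → V)
    (same-injective : ∀ {i j} → same i ≡ same j → i ≡ j)
    (same≢other : ∀ i j → same i ≢ other j)
    (colour-same : ∀ i j → colour (same i) (same j) ≡ mid i j + r)
    (colour-other : ∀ i → colour (same i) (other i) ≡ mid i i + r) where

    at-offset : ∀ i x {c} → r ≤ x → x < spread → c ≡ mid i (partner i (x ∸ r)) → c + r ≡ x
    at-offset i x r≤x x<s c≡ = trans (cong (_+ r) (trans c≡ (mid-partner i (x ∸ r) (∸-<-shift r≤x x<s))))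
                                     (m∸n+n≡m r≤x)

    middle-carries : ∀ i x → r ≤ x → x < spread → Carries (same i) x (middleNbr same other i (x ∸ r))
    middle-carries i x r≤x x<s with partner i (x ∸ r) FinP.≟ i
    ... | yes e = same≢other i i , trans (colour-other i) (at-offset i x r≤x x<s (cong (mid i) (≡-sym e)))
    ... | no ne = (ne ∘ ≡-sym ∘ same-injective) , trans (colour-same i _) (at-offset i x r≤x x<s refl)

    middle-same : ∀ i j → i ≢ j → middleNbr same other i (mid i j + r ∸ r) ≡ same j
    middle-same i j i≢j rewrite m+n∸n≡m (mid i j) r with partner i (mid i j) FinP.≟ i
    ... | yes e = ⊥-elim (i≢j (trans (≡-sym e) (partner-mid i j)))
    ... | no _  = cong same (partner-mid i j)

    middle-other : ∀ i → middleNbr same other i (mid i i + r ∸ r) ≡ other i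
    middle-other i rewrite m+n∸n≡m (mid i i) r with partner i (mid i i) FinP.≟ i
    ... | yes _ = refl
    ... | no ne = ⊥-elim (ne (partner-mid i i))

  module LeftMiddle  = MiddleBlock inj₁ inj₂ inj₁-injective (λ _ _ ()) (λ _ _ → refl) cross-≡
  module RightMiddle = MiddleBlock inj₂ inj₁ inj₂-injective (λ _ _ ()) (λ _ _ → refl) cross-≡

  above-offset : ∀ a x → x < a + spread → x ∸ (r + r) ≤ a
  above-offset a x x<hi = m≤n+o⇒m∸n≤o x (r + r)
    (subst (x ≤_) (+-comm a (r + r)) (≤-pred (subst (x <_) (+-suc a (r + r)) x<hi)))

  left-below : ∀ i x → r ∸ toℕ i ≤ x → x < r → cross i (fin (x ∸ (r ∸ toℕ i))) ≡ x
  left-below i x lo≤x x<r = begin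
      cross i (fin δ)           ≡⟨ cross-< i (fin δ) (subst (_< toℕ i) (≡-sym j≡) δ<i) ⟩
      toℕ (fin δ) + (r ∸ toℕ i) ≡⟨ cong (_+ (r ∸ toℕ i)) j≡ ⟩
      δ + (r ∸ toℕ i)           ≡⟨ m∸n+n≡m lo≤x ⟩
      x                         ∎
    where
      open ≡-Reasoning
      δ = x ∸ (r ∸ toℕ i)
      j≡ : toℕ (fin δ) ≡ δ
      j≡ = toℕ-fin (≤-<-trans (m∸n≤m x (r ∸ toℕ i)) (≤-trans x<r (n≤1+n r)))
      δ<i : δ < toℕ i
      δ<i = ∸-<-shift lo≤x (subst (x <_) (≡-sym (m+[n∸m]≡n (≤r i))) x<r)

  left-above : ∀ i x → spread ≤ x → x < (r ∸ toℕ i) + spread → cross i (fin (toℕ i + (x ∸ (r + r)))) ≡ x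
  left-above i x s≤x x<hi = begin
      cross i j                     ≡⟨ cross-> i j (subst (toℕ i <_) (≡-sym j≡) (m<m+n (toℕ i) (m<n⇒0<n∸m s≤x))) ⟩
      r + r + (toℕ j ∸ toℕ i)       ≡⟨ cong (λ z → r + r + (z ∸ toℕ i)) j≡ ⟩
      r + r + (toℕ i + δ ∸ toℕ i)   ≡⟨ cong (r + r +_) (m+n∸m≡n (toℕ i) δ) ⟩
      r + r + δ                     ≡⟨ m+[n∸m]≡n (<⇒≤ s≤x) ⟩
      x                             ∎
    where
      open ≡-Reasoning
      δ = x ∸ (r + r)
      j = fin (toℕ i + δ)
      j≡ : toℕ j ≡ toℕ i + δ
      j≡ = toℕ-fin (s≤s (≤-trans (+-monoʳ-≤ (toℕ i) (above-offset (r ∸ toℕ i) x x<hi))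
                                 (≤-reflexive (m+[n∸m]≡n (≤r i)))))

  right-below : ∀ j x → toℕ j ≤ x → x < r → cross (fin (r ∸ (x ∸ toℕ j))) j ≡ x
  right-below j x lo≤x x<r = begin
      cross i j               ≡⟨ cross-< i j (subst (toℕ j <_) (≡-sym i≡) j<r∸δ) ⟩
      toℕ j + (r ∸ toℕ i)     ≡⟨ cong (λ z → toℕ j + (r ∸ z)) i≡ ⟩
      toℕ j + (r ∸ (r ∸ δ))   ≡⟨ cong (toℕ j +_) (m∸[m∸n]≡n (≤-trans (m∸n≤m x (toℕ j)) (<⇒≤ x<r))) ⟩
      toℕ j + δ               ≡⟨ m+[n∸m]≡n lo≤x ⟩
      x                       ∎
    where
      open ≡-Reasoning
      δ = x ∸ toℕ j
      i = fin (r ∸ δ)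
      i≡ : toℕ i ≡ r ∸ δ
      i≡ = toℕ-fin (s≤s (m∸n≤m r δ))
      j<r∸δ : toℕ j < r ∸ δ
      j<r∸δ = m+n≤o⇒m≤o∸n (suc (toℕ j)) (subst (_< r) (≡-sym (m+[n∸m]≡n lo≤x)) x<r)

  right-above : ∀ j x → spread ≤ x → x < toℕ j + spread → cross (fin (toℕ j ∸ (x ∸ (r + r)))) j ≡ x
  right-above j x s≤x x<hi = begin
      cross i j                       ≡⟨ cross-> i j (subst (_< toℕ j) (≡-sym i≡) i<j) ⟩
      r + r + (toℕ j ∸ toℕ i)         ≡⟨ cong (λ z → r + r + (toℕ j ∸ z)) i≡ ⟩
      r + r + (toℕ j ∸ (toℕ j ∸ δ))   ≡⟨ cong (r + r +_) (m∸[m∸n]≡n δ≤j) ⟩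
      r + r + δ                       ≡⟨ m+[n∸m]≡n (<⇒≤ s≤x) ⟩
      x                               ∎
    where
      open ≡-Reasoning
      δ = x ∸ (r + r)
      δ≤j : δ ≤ toℕ j
      δ≤j = above-offset (toℕ j) x x<hi
      i = fin (toℕ j ∸ δ)
      i≡ : toℕ i ≡ toℕ j ∸ δ
      i≡ = toℕ-fin (≤-<-trans (m∸n≤m (toℕ j) δ) (toℕ<n j))
      i<j : toℕ j ∸ δ < toℕ j
      i<j = ∸-monoʳ-< {toℕ j} {δ} {0} (m<n⇒0<n∸m s≤x) δ≤j

  nbr : V → ℕ → V
  nbr (inj₁ i) x = byRegion x (inj₂ (fin (x ∸ (r ∸ toℕ i))))
                              (middleNbr inj₁ inj₂ i (x ∸ r))
                              (inj₂ (fin (toℕ i + (x ∸ (r + r)))))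
  nbr (inj₂ j) x = byRegion x (inj₁ (fin (r ∸ (x ∸ toℕ j))))
                              (middleNbr inj₂ inj₁ j (x ∸ r))
                              (inj₁ (fin (toℕ j ∸ (x ∸ (r + r)))))

  nbr-carries : ∀ u x → low u ≤ x → x < low u + spread → Carries u x (nbr u x)
  nbr-carries (inj₁ i) x lo≤x x<hi with region x
  ... | below x<r      = (λ ()) , left-below i x lo≤x x<r
  ... | middle r≤x x<s = LeftMiddle.middle-carries i x r≤x x<s
  ... | above s≤x      = (λ ()) , left-above i x s≤x x<hi
  nbr-carries (inj₂ j) x lo≤x x<hi with region x
  ... | below x<r      = (λ ()) , right-below j x lo≤x x<r
  ... | middle r≤x x<s = RightMiddle.middle-carries j x r≤x x<s
  ... | above s≤x      = (λ ()) , right-above j x s≤x x<hi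

  middle-colour : ∀ {A : Set} i j {a b c : A} → byRegion (mid i j + r) a b c ≡ b
  middle-colour i j = byRegion-middle (m≤n+m r _) (s≤s (+-monoˡ-≤ r (≤-pred (mid<p i j))))

  cross-below : ∀ (i j : Fin p) → toℕ j < toℕ i → toℕ j + (r ∸ toℕ i) < r
  cross-below i j j<i = subst (toℕ j + (r ∸ toℕ i) <_) (m+[n∸m]≡n (≤r i)) (+-monoˡ-< (r ∸ toℕ i) j<i)

  cross-above : ∀ (i j : Fin p) → toℕ i < toℕ j → spread ≤ r + r + (toℕ j ∸ toℕ i)
  cross-above i j i<j = m<m+n (r + r) (m<n⇒0<n∸m i<j)

  nbr-cross-left : ∀ i j → nbr (inj₁ i) (cross i j) ≡ inj₂ j
  nbr-cross-left i j with <-cmp (toℕ j) (toℕ i)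
  ... | tri< j<i _ _ = trans (byRegion-below (cross-below i j j<i)) (cong inj₂ (begin
      fin (toℕ j + (r ∸ toℕ i) ∸ (r ∸ toℕ i)) ≡⟨ cong fin (m+n∸n≡m (toℕ j) (r ∸ toℕ i)) ⟩
      fin (toℕ j)                             ≡⟨ fin-toℕ j ⟩
      j                                       ∎))
    where open ≡-Reasoning
  ... | tri≈ _ e _ rewrite toℕ-injective e = trans (middle-colour i i) (LeftMiddle.middle-other i)
  ... | tri> _ _ i<j = trans (byRegion-above (cross-above i j i<j)) (cong inj₂ (begin
      fin (toℕ i + (r + r + (toℕ j ∸ toℕ i) ∸ (r + r))) ≡⟨ cong (λ z → fin (toℕ i + z)) (m+n∸m≡n (r + r) _) ⟩
      fin (toℕ i + (toℕ j ∸ toℕ i))                     ≡⟨ cong fin (m+[n∸m]≡n (<⇒≤ i<j)) ⟩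
      fin (toℕ j)                                       ≡⟨ fin-toℕ j ⟩
      j                                                 ∎))
    where open ≡-Reasoning

  nbr-cross-right : ∀ i j → nbr (inj₂ j) (cross i j) ≡ inj₁ i
  nbr-cross-right i j with <-cmp (toℕ j) (toℕ i)
  ... | tri< j<i _ _ = trans (byRegion-below (cross-below i j j<i)) (cong inj₁ (begin
      fin (r ∸ (toℕ j + (r ∸ toℕ i) ∸ toℕ j)) ≡⟨ cong (λ z → fin (r ∸ z)) (m+n∸m≡n (toℕ j) (r ∸ toℕ i)) ⟩
      fin (r ∸ (r ∸ toℕ i))                   ≡⟨ cong fin (m∸[m∸n]≡n (≤r i)) ⟩
      fin (toℕ i)                             ≡⟨ fin-toℕ i ⟩
      i                                       ∎))
    where open ≡-Reasoning
  ... | tri≈ _ e _ rewrite toℕ-injective e = trans (middle-colour i i) (RightMiddle.middle-other i)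
  ... | tri> _ _ i<j = trans (byRegion-above (cross-above i j i<j)) (cong inj₁ (begin
      fin (toℕ j ∸ (r + r + (toℕ j ∸ toℕ i) ∸ (r + r))) ≡⟨ cong (λ z → fin (toℕ j ∸ z)) (m+n∸m≡n (r + r) _) ⟩
      fin (toℕ j ∸ (toℕ j ∸ toℕ i))                     ≡⟨ cong fin (m∸[m∸n]≡n (<⇒≤ i<j)) ⟩
      fin (toℕ i)                                       ≡⟨ fin-toℕ i ⟩
      i                                                 ∎))
    where open ≡-Reasoning

  nbr-colour : ∀ u v → u ≢ v → nbr u (colour u v) ≡ v
  nbr-colour (inj₁ i) (inj₁ j) ne = trans (middle-colour i j) (LeftMiddle.middle-same i j (ne ∘ cong inj₁))
  nbr-colour (inj₂ i) (inj₂ j) ne = trans (middle-colour i j) (RightMiddle.middle-same i j (ne ∘ cong inj₂))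
  nbr-colour (inj₁ i) (inj₂ j) _  = nbr-cross-left i j
  nbr-colour (inj₂ j) (inj₁ i) _  = nbr-cross-right i j

  low-bound : ∀ u → low u + spread ≤ span
  low-bound (inj₁ i) = +-monoˡ-≤ spread (m∸n≤m r (toℕ i))
  low-bound (inj₂ j) = +-monoˡ-≤ spread (≤r j)

  covered : ∀ x → x < span → Σ V λ u → low u ≤ x × x < low u + spread
  covered x x<span with x <? spread
  ... | yes x<s = inj₂ Fin.zero , z≤n , x<s
  ... | no x≮s  = inj₁ Fin.zero , ≤-trans r≤spread (≮⇒≥ x≮s) , x<span

  base : CompleteIntervalColouring V spread span
  base = record
    { decEq      = ≡-dec FinP._≟_ FinP._≟_
    ; colour     = colour
    ; colour-sym = colour-sym
    ; low        = low
    ; low≤colour = λ u v _ → proj₁ (colour-range u v)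
    ; colour<    = λ u v _ → proj₂ (colour-range u v)
    ; nbr        = nbr
    ; nbr-≢      = λ u x lo hi → proj₁ (nbr-carries u x lo hi)
    ; colour-nbr = λ u x lo hi → proj₂ (nbr-carries u x lo hi)
    ; nbr-colour = nbr-colour
    ; low-bound  = low-bound
    ; covered    = covered
    ; top        = inj₁ Fin.zero
    ; top-low    = refl
    }

open Base using (base)

-- Blow-up: a complete interval colouring of K_k with spread d ≥ 1 and span t
-- gives an interval (nt + m)-colouring of K-balanced k n, n = m + 1 (the
-- paper's colours 1, …, nt + m are our colours shifted by one).  A vertex x
-- is the pair (part x, slot x) with x = n·part x + slot x.  The
-- edge between x and y in different parts gets the colour
-- n·colour (part x) (part y) + slot x + slot y.  As slot y runs through
-- 0, …, n − 1 and part y through the other parts, these colours fill the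
-- interval [n·low (part x) + slot x, n·low (part x) + slot x + n·d) exactly
-- once.  The hypothesis d ≥ 1 makes the star of the last vertex of the top
-- part reach the top colour.
module BlowUp {k d t : ℕ} (m : ℕ) (C : CompleteIntervalColouring (Fin k) d t) (1≤d : 1 ≤ d) where
  open CompleteIntervalColouring C

  n : ℕ
  n = suc m

  G : Graph
  G = K-balanced k n

  X : Set
  X = Fin (k * n)

  part : X → Fin k
  part x = proj₁ (remQuot {k} n x)

  slot : X → ℕ
  slot x = toℕ (proj₂ (remQuot {k} n x))

  slot<n : ∀ x → slot x < n
  slot<n x = toℕ<n (proj₂ (remQuot {k} n x))

  part-combine : ∀ a b → part (combine a b) ≡ a
  part-combine a b = cong proj₁ (remQuot-combine {k} {n} a b)

  slot-combine : ∀ a b → slot (combine a b) ≡ toℕ b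
  slot-combine a b = cong (toℕ ∘ proj₂) (remQuot-combine {k} {n} a b)

  combine-part-slot : ∀ y a b → a ≡ part y → toℕ b ≡ slot y → combine a b ≡ y
  combine-part-slot y a b a≡ b≡ = trans (cong₂ combine a≡ (toℕ-injective b≡)) (combine-remQuot {k} n y)

  decompose : ∀ x → toℕ x ≡ n * toℕ (part x) + slot x
  decompose x = trans (cong toℕ (≡-sym (combine-remQuot {k} n x))) (toℕ-combine (part x) _)

  n*a+b≡b+a*n : ∀ a b → n * a + b ≡ b + a * n
  n*a+b≡b+a*n a b = trans (+-comm (n * a) b) (cong (b +_) (*-comm n a))

  quotient : ∀ a b → b < n → (n * a + b) / n ≡ a
  quotient a b b<n = begin
      (n * a + b) / n   ≡⟨ cong (_/ n) (n*a+b≡b+a*n a b) ⟩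
      (b + a * n) / n   ≡⟨ +-distrib-/ b (a * n) no-carry ⟩
      b / n + a * n / n ≡⟨ cong₂ _+_ (m<n⇒m/n≡0 b<n) (m*n/n≡m a n) ⟩
      a                 ∎
    where
      open ≡-Reasoning
      no-carry : b % n + (a * n) % n < n
      no-carry = subst (_< n) (≡-sym (cong₂ _+_ (m<n⇒m%n≡m b<n) (m*n%n≡0 a n)))
                                   (subst (_< n) (≡-sym (+-identityʳ b)) b<n)

  remainder : ∀ a b → b < n → (n * a + b) % n ≡ b
  remainder a b b<n = trans (cong (_% n) (n*a+b≡b+a*n a b)) (trans ([m+kn]%n≡m%n b a n) (m<n⇒m%n≡m b<n))

  partOf≡part : ∀ x → partOf k n x ≡ toℕ (part x)
  partOf≡part x = trans (cong (_/ n) (decompose x)) (quotient (toℕ (part x)) (slot x) (slot<n x))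

  adjacent⇒≢ : ∀ x y → Adj G x y → part x ≢ part y
  adjacent⇒≢ x y adj e = adj (trans (partOf≡part x) (trans (cong toℕ e) (≡-sym (partOf≡part y))))

  ≢⇒adjacent : ∀ x y → part x ≢ part y → Adj G x y
  ≢⇒adjacent x y ne e = ne (toℕ-injective (trans (≡-sym (partOf≡part x)) (trans e (partOf≡part y))))

  colourᴮ : X → X → ℕ
  colourᴮ x y = n * colour (part x) (part y) + slot x + slot y

  colourᴮ-sym : ∀ x y → colourᴮ x y ≡ colourᴮ y x
  colourᴮ-sym x y = trans (cong (λ c → n * c + slot x + slot y) (colour-sym (part x) (part y)))
                          (swap (n * colour (part y) (part x)) (slot x) (slot y))
    where swap : ∀ a b c → a + b + c ≡ a + c + b
          swap = solve-∀

  lowᴮ : X → ℕ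
  lowᴮ x = n * low (part x) + slot x

  spanᴮ : ℕ
  spanᴮ = n * t + m

  regroup : ∀ a b c → n * a + c + n * b ≡ n * (a + b) + c
  regroup a b c = identity n a b c
    where identity : ∀ n a b c → n * a + c + n * b ≡ n * (a + b) + c
          identity = solve-∀

  lowᴮ≤colourᴮ : ∀ x y → part x ≢ part y → lowᴮ x ≤ colourᴮ x y
  lowᴮ≤colourᴮ x y ne = ≤-trans (+-monoˡ-≤ (slot x) (*-monoʳ-≤ n (low≤colour _ _ ne))) (m≤m+n _ _)

  colourᴮ< : ∀ x y → part x ≢ part y → colourᴮ x y < lowᴮ x + n * d
  colourᴮ< x y ne = begin-strict
      n * c + slot x + slot y         <⟨ +-monoʳ-< (n * c + slot x) (slot<n y) ⟩
      n * c + slot x + n              ≡⟨ shift n c (slot x) ⟩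
      slot x + n * suc c              ≤⟨ +-monoʳ-≤ (slot x) (*-monoʳ-≤ n (colour< _ _ ne)) ⟩
      slot x + n * (low (part x) + d) ≡⟨ cong (slot x +_) (*-distribˡ-+ n (low (part x)) d) ⟩
      slot x + (n * low (part x) + n * d) ≡⟨ +-assoc-swap (slot x) (n * low (part x)) (n * d) ⟩
      n * low (part x) + slot x + n * d ∎
    where
      open ≤-Reasoning
      c = colour (part x) (part y)
      shift : ∀ n c s → n * c + s + n ≡ s + n * suc c
      shift = solve-∀
      +-assoc-swap : ∀ a b c → a + (b + c) ≡ b + a + c
      +-assoc-swap = solve-∀

  lowᴮ-bound : ∀ x → lowᴮ x + n * d ≤ spanᴮ
  lowᴮ-bound x = begin
      n * low (part x) + slot x + n * d ≡⟨ regroup (low (part x)) d (slot x) ⟩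
      n * (low (part x) + d) + slot x   ≤⟨ +-mono-≤ (*-monoʳ-≤ n (low-bound (part x))) (≤-pred (slot<n x)) ⟩
      n * t + m                         ∎
    where open ≤-Reasoning

  colourᴮ<span : ∀ x y → part x ≢ part y → colourᴮ x y < spanᴮ
  colourᴮ<span x y ne = <-≤-trans (colourᴮ< x y ne) (lowᴮ-bound x)

  star-quotient : ∀ x z → lowᴮ x ≤ z → z < lowᴮ x + n * d →
                  low (part x) ≤ (z ∸ slot x) / n × (z ∸ slot x) / n < low (part x) + d
                  × (z ∸ slot x) + slot x ≡ z
  star-quotient x z lo≤z z<hi = lo≤q , q<hi , w+s≡z
    where
      l = low (part x)
      w = z ∸ slot x
      w+s≡z : w + slot x ≡ z
      w+s≡z = m∸n+n≡m (≤-trans (m≤n+m (slot x) (n * l)) lo≤z)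
      nl≤w : n * l ≤ w
      nl≤w = +-cancelʳ-≤ (slot x) (n * l) w (subst (n * l + slot x ≤_) (≡-sym w+s≡z) lo≤z)
      w<hi : w < (l + d) * n
      w<hi = +-cancelʳ-< (slot x) w ((l + d) * n)
               (subst₂ _<_ (≡-sym w+s≡z) (trans (regroup l d (slot x)) (cong (_+ slot x) (*-comm n (l + d)))) z<hi)
      lo≤q : l ≤ w / n
      lo≤q = subst (_≤ w / n) (trans (cong (_/ n) (*-comm n l)) (m*n/n≡m l n)) (/-monoˡ-≤ n nl≤w)
      q<hi : w / n < l + d
      q<hi = m<n*o⇒m/o<n w<hi

  nbrᴮ : X → ℕ → X
  nbrᴮ x z = combine (nbr (part x) ((z ∸ slot x) / n)) (fromℕ< (m%n<n (z ∸ slot x) n))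

  nbrᴮ-ok : ∀ x z → lowᴮ x ≤ z → z < lowᴮ x + n * d →
            part x ≢ part (nbrᴮ x z) × colourᴮ x (nbrᴮ x z) ≡ z
  nbrᴮ-ok x z lo≤z z<hi with star-quotient x z lo≤z z<hi
  ... | lo≤q , q<hi , w+s≡z = (λ e → nbr-≢ (part x) q lo≤q q<hi (trans e (part-combine _ _))) , (begin
      n * colour (part x) (part y) + slot x + slot y
        ≡⟨ cong₂ (λ a b → n * colour (part x) a + slot x + b)
                 (part-combine _ _) (trans (slot-combine _ _) (toℕ-fromℕ< _)) ⟩
      n * colour (part x) (nbr (part x) q) + slot x + w % n
        ≡⟨ cong (λ c → n * c + slot x + w % n) (colour-nbr (part x) q lo≤q q<hi) ⟩
      n * q + slot x + w % n
        ≡⟨ rearrange n q (slot x) (w % n) ⟩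
      w % n + q * n + slot x
        ≡⟨ cong (_+ slot x) (≡-sym (m≡m%n+[m/n]*n w n)) ⟩
      w + slot x
        ≡⟨ w+s≡z ⟩
      z ∎)
    where
      open ≡-Reasoning
      w = z ∸ slot x
      q = w / n
      y = nbrᴮ x z
      rearrange : ∀ n q s r → n * q + s + r ≡ r + q * n + s
      rearrange = solve-∀

  nbrᴮ-colourᴮ : ∀ x y → part x ≢ part y → nbrᴮ x (colourᴮ x y) ≡ y
  nbrᴮ-colourᴮ x y ne = combine-part-slot y _ _ part≡ slot≡
    where
      c = colour (part x) (part y)
      w≡ : colourᴮ x y ∸ slot x ≡ n * c + slot y
      w≡ = trans (cong (_∸ slot x) (swap (n * c) (slot x) (slot y))) (m+n∸n≡m (n * c + slot y) (slot x))
        where swap : ∀ a b c → a + b + c ≡ a + c + b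
              swap = solve-∀
      part≡ : nbr (part x) ((colourᴮ x y ∸ slot x) / n) ≡ part y
      part≡ = trans (cong (λ v → nbr (part x) (v / n)) w≡)
                    (trans (cong (nbr (part x)) (quotient c (slot y) (slot<n y))) (nbr-colour _ _ ne))
      slot≡ : toℕ (fromℕ< (m%n<n (colourᴮ x y ∸ slot x) n)) ≡ slot y
      slot≡ = trans (toℕ-fromℕ< _) (trans (cong (_% n) w≡) (remainder c (slot y) (slot<n y)))

  lowᴮ-combine : ∀ a b → lowᴮ (combine a b) ≡ n * low a + toℕ b
  lowᴮ-combine a b = cong₂ (λ u s → n * low u + s) (part-combine a b) (slot-combine a b)

  covered-inside : ∀ z u → low u ≤ z / n → z / n < low u + d →
                   lowᴮ (combine u Fin.zero) ≤ z × z < lowᴮ (combine u Fin.zero) + n * d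
  covered-inside z u lo≤q q<hi rewrite lowᴮ-combine u Fin.zero = lo≤z , z<hi
    where
      q = z / n
      z≡ : z ≡ z % n + q * n
      z≡ = m≡m%n+[m/n]*n z n
      lo≤z : n * low u + 0 ≤ z
      lo≤z = begin
          n * low u + 0 ≡⟨ +-identityʳ _ ⟩
          n * low u     ≤⟨ *-monoʳ-≤ n lo≤q ⟩
          n * q         ≡⟨ *-comm n q ⟩
          q * n         ≤⟨ m≤n+m (q * n) (z % n) ⟩
          z % n + q * n ≡⟨ z≡ ⟨
          z             ∎
        where open ≤-Reasoning
      z<hi : z < n * low u + 0 + n * d
      z<hi = begin-strict
          z                     ≡⟨ z≡ ⟩
          z % n + q * n         <⟨ +-monoˡ-< (q * n) (m%n<n z n) ⟩
          n + q * n             ≡⟨ cong (n +_) (*-comm q n) ⟩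
          n + n * q             ≡⟨ *-suc n q ⟨
          n * suc q             ≤⟨ *-monoʳ-≤ n q<hi ⟩
          n * (low u + d)       ≡⟨ *-distribˡ-+ n (low u) d ⟩
          n * low u + n * d     ≡⟨ cong (_+ n * d) (+-identityʳ (n * low u)) ⟨
          n * low u + 0 + n * d ∎
        where open ≤-Reasoning

  covered-top : ∀ z → t ≤ z / n → z < spanᴮ →
                lowᴮ (combine top (fromℕ m)) ≤ z × z < lowᴮ (combine top (fromℕ m)) + n * d
  covered-top z t≤q z<span rewrite lowᴮ-combine top (fromℕ m) | toℕ-fromℕ m = lo≤z , z<hi
    where
      q = z / n
      m≤nd : m ≤ n * d
      m≤nd = ≤-trans (n≤1+n m) (subst (_≤ n * d) (*-identityʳ n) (*-monoʳ-≤ n 1≤d))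
      lo≤z : n * low top + m ≤ z
      lo≤z = begin
          n * low top + m     ≤⟨ +-monoʳ-≤ (n * low top) m≤nd ⟩
          n * low top + n * d ≡⟨ *-distribˡ-+ n (low top) d ⟨
          n * (low top + d)   ≡⟨ cong (n *_) top-low ⟩
          n * t               ≤⟨ *-monoʳ-≤ n t≤q ⟩
          n * q               ≡⟨ *-comm n q ⟩
          q * n               ≤⟨ m≤n+m (q * n) (z % n) ⟩
          z % n + q * n       ≡⟨ m≡m%n+[m/n]*n z n ⟨
          z                   ∎
        where open ≤-Reasoning
      z<hi : z < n * low top + m + n * d
      z<hi = subst (z <_) (trans (cong (λ v → n * v + m) (≡-sym top-low)) (≡-sym (regroup (low top) d m))) z<span

  coveredᴮ : ∀ z → z < spanᴮ → Σ X λ x → lowᴮ x ≤ z × z < lowᴮ x + n * d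
  coveredᴮ z z<span with z / n <? t
  ... | yes q<t with covered (z / n) q<t
  ...   | u , lo≤q , q<hi = combine u Fin.zero , covered-inside z u lo≤q q<hi
  coveredᴮ z z<span | no q≮t = combine top (fromℕ m) , covered-top z (≮⇒≥ q≮t) z<span

  edgeColouring : EdgeColoring G
  edgeColouring = record { col = λ x y _ → suc (colourᴮ x y) ; col-sym = λ x y _ → cong suc (colourᴮ-sym x y) }

  reach : ∀ v i → suc (lowᴮ v) ≤ i → i ≤ lowᴮ v + n * d →
          Σ X λ w → Σ (Adj G v w) λ _ → suc (colourᴮ v w) ≡ i
  reach v (suc z) (s≤s lo≤z) z<hi with nbrᴮ-ok v z lo≤z z<hi
  ... | ne , colour≡ = nbrᴮ v z , ≢⇒adjacent v _ ne , cong suc colour≡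

  isInterval : IsIntervalColoring G spanᴮ edgeColouring
  isInterval = record
    { range    = λ u v adj → s≤s z≤n , colourᴮ<span u v (adjacent⇒≢ u v adj)
    ; surj     = λ { (suc z) _ z<span → case-surj z z<span }
    ; proper   = λ v u w a b u≢w e → u≢w (trans (≡-sym (nbrᴮ-colourᴮ v u (adjacent⇒≢ v u a)))
                   (trans (cong (nbrᴮ v) (suc-injective e)) (nbrᴮ-colourᴮ v w (adjacent⇒≢ v w b))))
    ; interval = λ v u _ → suc (lowᴮ v) , lowᴮ v + n * d
                         , (λ w adj → s≤s (lowᴮ≤colourᴮ v w (adjacent⇒≢ v w adj)) , colourᴮ< v w (adjacent⇒≢ v w adj))
                         , reach v
    }
    where
      case-surj : ∀ z → z < spanᴮ → Σ X λ u → Σ X λ v → Σ (Adj G u v) λ _ → suc (colourᴮ u v) ≡ suc z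
      case-surj z z<span with coveredᴮ z z<span
      ... | x , lo≤z , z<hi = x , reach x (suc z) (s≤s lo≤z) z<hi

blowUp : ∀ {k d t} m → CompleteIntervalColouring (Fin k) d t → 1 ≤ d →
         HasIntervalColoring (K-balanced k (suc m)) (suc m * t + m)
blowUp m C 1≤d = BlowUp.edgeColouring m C 1≤d , BlowUp.isInterval m C 1≤d

order spreadᵀ spanᵀ : ℕ → ℕ → ℕ
order r zero    = suc r + suc r
order r (suc q) = order r q + order r q

spreadᵀ r zero    = Base.spread r
spreadᵀ r (suc q) = suc (spreadᵀ r q + spreadᵀ r q)

spanᵀ r zero    = Base.span r
spanᵀ r (suc q) = spanᵀ r q + suc (spreadᵀ r q + spreadᵀ r q)

tower : ∀ r q → CompleteIntervalColouring (Fin (order r q)) (spreadᵀ r q) (spanᵀ r q)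
tower r zero    = onFin (base r)
tower r (suc q) = onFin (double (tower r q))

spreadᵀ-positive : ∀ r q → 1 ≤ spreadᵀ r q
spreadᵀ-positive r zero    = s≤s z≤n
spreadᵀ-positive r (suc q) = s≤s z≤n

order≡p*2^q : ∀ r q → order r q ≡ suc r * 2 ^ suc q
order≡p*2^q r zero    = double≡*2 (suc r)
  where double≡*2 : ∀ a → a + a ≡ a * 2
        double≡*2 = solve-∀
order≡p*2^q r (suc q) = trans (cong₂ _+_ (order≡p*2^q r q) (order≡p*2^q r q)) (sum≡*2 (suc r) (2 ^ suc q))
  where sum≡*2 : ∀ a x → a * x + a * x ≡ a * (2 * x)
        sum≡*2 = solve-∀

order≡suc-spreadᵀ : ∀ r q → order r q ≡ suc (spreadᵀ r q)
order≡suc-spreadᵀ r zero    = +-suc (suc r) r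
order≡suc-spreadᵀ r (suc q) = trans (cong₂ _+_ (order≡suc-spreadᵀ r q) (order≡suc-spreadᵀ r q))
                                   (+-suc (suc (spreadᵀ r q)) (spreadᵀ r q))

-- One doubling preserves the relation 2K = t + 1 + p + q.
doubling-law : ∀ K d t a b → K ≡ suc d → 2 * K ≡ suc t + a + b →
               2 * (K + K) ≡ suc (t + suc (d + d)) + a + suc b
doubling-law .(suc d) d t a b refl law = trans (split (suc d)) (trans (cong (_+ 2 * suc d) law) (regroup t a b d))
  where
    split : ∀ K → 2 * (K + K) ≡ 2 * K + 2 * K
    split = solve-∀
    regroup : ∀ t a b d → suc t + a + b + 2 * suc d ≡ suc (t + suc (d + d)) + a + suc b
    regroup = solve-∀

span-law : ∀ r q → 2 * order r q ≡ suc (spanᵀ r q) + suc r + suc q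
span-law r zero    = base-law r
  where base-law : ∀ r → 2 * (suc r + suc r) ≡ suc (r + suc (r + r)) + suc r + 1
        base-law = solve-∀
span-law r (suc q) = doubling-law (order r q) (spreadᵀ r q) (spanᵀ r q) (suc r) (suc q)
                                  (order≡suc-spreadᵀ r q) (span-law r q)

blown-up-span : ∀ t a b m → (suc t + a + b ∸ a ∸ b) * suc m ∸ 1 ≡ suc m * t + m
blown-up-span t a b m = trans (cong (λ z → z * suc m ∸ 1) cancel) (reorder t m)
  where
    cancel : suc t + a + b ∸ a ∸ b ≡ suc t
    cancel = begin
        suc t + a + b ∸ a ∸ b   ≡⟨ ∸-+-assoc (suc t + a + b) a b ⟩
        suc t + a + b ∸ (a + b) ≡⟨ cong (_∸ (a + b)) (+-assoc (suc t) a b) ⟩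
        suc t + (a + b) ∸ (a + b) ≡⟨ m+n∸n≡m (suc t) (a + b) ⟩
        suc t ∎
      where open ≡-Reasoning
    reorder : ∀ t m → m + t * suc m ≡ suc m * t + m
    reorder = solve-∀

theorem8 : ∀ (n p q k : ℕ) → 1 ≤ n → 1 ≤ p → p % 2 ≡ 1 → 1 ≤ q →
    k ≡ p * 2 ^ q →
    W≥ (K-balanced k n) ((2 * k ∸ p ∸ q) * n ∸ 1)
theorem8 zero    p       q       k ()  _   _ _   _
theorem8 (suc m) zero    q       k _   ()  _ _   _
theorem8 (suc m) (suc r) zero    k _   _   _ ()  _
theorem8 (suc m) (suc r) (suc q) k _   _   _ _   k≡ =
  suc m * spanᵀ r q + m , ≤-reflexive bound≡
    , subst (λ K → HasIntervalColoring (K-balanced K (suc m)) _) order≡k colouring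
  where
    colouring : HasIntervalColoring (K-balanced (order r q) (suc m)) (suc m * spanᵀ r q + m)
    colouring = blowUp m (tower r q) (spreadᵀ-positive r q)
    order≡k : order r q ≡ k
    order≡k = trans (order≡p*2^q r q) (≡-sym k≡)
    bound≡ : (2 * k ∸ suc r ∸ suc q) * suc m ∸ 1 ≡ suc m * spanᵀ r q + m
    bound≡ = trans (cong (λ K → (2 * K ∸ suc r ∸ suc q) * suc m ∸ 1) (≡-sym order≡k))
            (trans (cong (λ x → (x ∸ suc r ∸ suc q) * suc m ∸ 1) (span-law r q))
                   (blown-up-span (spanᵀ r q) (suc r) (suc q) m))
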